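{- Let $\mathbb{K}$ be a field, $\rho:\mathbb{N}^+\to\mathbb{K}$ any function, and $f(x)\in\mathbb{K}[[x]]$ with $$\sum_{n\ge 1}\Big(\sum_{T\in PT(n)}\prod_{h\in\mathcal{H}(T)}\rho(h)\Big)x^n=f(x).$$ Then for every $n\ge1$ with $[x^{n-1}]\frac{1}{1-f(x)}\neq 0$, $$\rho(n)=\frac{[x^n]f(x)}{[x^{n-1}]\frac{1}{1-f(x)}}.$$
   Context: A plane tree is a rooted unlabeled tree in which the (nonempty) subtrees of each vertex are arranged in linear order; $PT(n)$ denotes the set of plane trees with $n$ vertices. For a vertex $u$ of a tree $T$, the hook length $h_u$ is the number of descendants of $u$ (counting $u$ itself), and $\mathcal{H}(T)$ is the multiset of hook lengths of the vertices; the product over $\mathcal{H}(T)$ is the product over all vertices. $[x^n]g(x)$ is the coefficient of $x^n$ in $g(x)$. -}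

module Defs where

open import Level using (Level; _⊔_) renaming (suc to lsuc)
open import Algebra.Bundles using (CommutativeRing)
open import Data.Nat using (ℕ; zero; suc; _∸_; _≤_) renaming (_+_ to _+ℕ_)
open import Data.List using (List; []; _∷_; map)
open import Data.List.Membership.Propositional using (_∈_)
open import Data.List.Relation.Unary.All using (All)
open import Data.List.Relation.Unary.Unique.Propositional using (Unique)
open import Relation.Binary.PropositionalEquality using (_≡_)
open import Relation.Nullary using (¬_)

record Field (c ℓ : Level) : Set (lsuc (c ⊔ ℓ)) where
  field
    commutativeRing : CommutativeRing c ℓ
  open CommutativeRing commutativeRing public
  field
    0≉1   : ¬ (0# ≈ 1#)
    inv   : (x : Carrier) → ¬ (x ≈ 0#) → Carrier
    inv-r : (x : Carrier) (p : ¬ (x ≈ 0#)) → (x * inv x p) ≈ 1#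

-- Plane trees: a vertex with a linearly ordered (possibly empty) list of subtrees.
data PTree : Set where
  node : List PTree → PTree

mutual
  size : PTree → ℕ
  size (node ts) = suc (sizeF ts)

  sizeF : List PTree → ℕ
  sizeF []       = 0
  sizeF (t ∷ ts) = size t +ℕ sizeF ts

-- PT(n) as a finite set is represented by any duplicate-free list that
-- contains exactly the plane trees with n vertices.
EnumeratesPT : ℕ → List PTree → Set
EnumeratesPT n L = ((t : PTree) → size t ≡ n → t ∈ L)
                 × All (λ t → size t ≡ n) L
                 × Unique L
  where open import Data.Product using (_×_)

module FieldOps {c ℓ : Level} (K : Field c ℓ) where
  open Field K

  Series : Set c
  Series = ℕ → Carrier

  sumL : List Carrier → Carrier
  sumL []       = 0#
  sumL (x ∷ xs) = x + sumL xs

  mutual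
    -- product over the multiset of hook lengths of ρ(h): the hook length
    -- of the root of a subtree is the size of that subtree
    hookProd : (ℕ → Carrier) → PTree → Carrier
    hookProd ρ (node ts) = ρ (size (node ts)) * hookProdF ρ ts

    hookProdF : (ℕ → Carrier) → List PTree → Carrier
    hookProdF ρ []       = 1#
    hookProdF ρ (t ∷ ts) = hookProd ρ t * hookProdF ρ ts

  convAux : Series → Series → ℕ → ℕ → Carrier
  convAux a b n zero    = a 0 * b n
  convAux a b n (suc k) = a (suc k) * b (n ∸ suc k) + convAux a b n k

  _⊛_ : Series → Series → Series
  (a ⊛ b) n = convAux a b n n

  oneS : Series
  oneS zero    = 1#
  oneS (suc _) = 0#

  oneMinus : Series → Series
  oneMinus f n = oneS n - f n

  IsHookSeries : (ℕ → Carrier) → Series → Set ℓ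
  IsHookSeries ρ f = (f 0 ≈ 0#)
    × ((n : ℕ) → 1 ≤ n → (L : List PTree) → EnumeratesPT n L →
         f n ≈ sumL (map (hookProd ρ) L))
    where open import Data.Product using (_×_)

  IsInvOneMinus : Series → Series → Set ℓ
  IsInvOneMinus f g = (m : ℕ) → (oneMinus f ⊛ g) m ≈ oneS m

-- Let G m be the sum of Π ρ(h) over all forests (lists of plane trees) with m
-- vertices in total.  A tree with n vertices is a root over a forest with
-- n − 1 vertices, and the root's hook length is n, so [xⁿ] f = ρ(n) G(n − 1).
-- Splitting a forest into its first tree and the rest gives G 0 = 1 and
-- G m = Σ_{k=1}^{m} [xᵏ] f · G(m − k), which is exactly the recurrence that
-- (1 − f) g = 1 imposes on g.  Hence G = g, and dividing by g(n − 1) ≠ 0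
-- recovers ρ(n).
module Submission where

open import Defs
open import Data.Nat using (ℕ; zero; suc; _∸_; _≤_; _<_; z≤n; s≤s) renaming (_+_ to _+ℕ_)
open import Data.Nat.Properties
  using (≤-refl; ≤-trans; ≤-<-trans; <⇒≤; <-irrefl; n<1+n; m<n⇒m<1+n; m<1+n⇒m<n∨m≡n;
         ≤-pred; m≤m+n; m≤n+m; m∸n≤m; m+n∸m≡n; m+[n∸m]≡n)
open import Data.List using (List; []; _∷_; map; _++_; cartesianProductWith)
open import Data.List.Properties using (map-++; map-∘)
open import Data.List.Membership.Propositional using (_∈_; _∉_)
open import Data.List.Membership.Propositional.Properties
  using (∈-cartesianProductWith⁺; ∈-cartesianProductWith⁻; ∈-++⁺ˡ; ∈-++⁺ʳ; ∈-++⁻; ∈-map⁺; ∈-map⁻)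
open import Data.List.Relation.Unary.All as All using (All)
open import Data.List.Relation.Unary.Any using (here)
open import Data.List.Relation.Unary.Unique.Propositional using (Unique)
import Data.List.Relation.Unary.Unique.Propositional.Properties as Unique
import Data.List.Relation.Unary.AllPairs as AllPairs
open import Data.Product using (_×_; _,_; ∃; ∃₂; proj₁; proj₂)
open import Data.Sum using (inj₁; inj₂)
open import Function using (_∘_)
open import Relation.Nullary using (¬_)
import Relation.Binary.PropositionalEquality as ≡
open ≡ using (_≡_; refl)

consNode : List PTree → List PTree → List PTree
consNode cs rest = node cs ∷ rest

consNode-injective : ∀ {cs cs′ rest rest′} →
  consNode cs rest ≡ consNode cs′ rest′ → cs ≡ cs′ × rest ≡ rest′
consNode-injective refl = refl , refl

node-injective : ∀ {cs cs′} → node cs ≡ node cs′ → cs ≡ cs′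
node-injective refl = refl

-- The fuel makes the recursion structural; forests fuel m lists the forests
-- with m vertices whenever m < fuel.
mutual
  forests : ℕ → ℕ → List (List PTree)
  forests zero       _       = []
  forests (suc fuel) zero    = [] ∷ []
  forests (suc fuel) (suc m) = forestsFirstAtMost fuel m (suc m)

  -- forests with 1 + m vertices whose first tree has 1 + k vertices
  forestsWithFirst : ℕ → ℕ → ℕ → List (List PTree)
  forestsWithFirst fuel m k =
    cartesianProductWith consNode (forests fuel k) (forests fuel (m ∸ k))

  -- forests with 1 + m vertices whose first tree has at most j vertices
  forestsFirstAtMost : ℕ → ℕ → ℕ → List (List PTree)
  forestsFirstAtMost fuel m zero    = []
  forestsFirstAtMost fuel m (suc j) =
    forestsWithFirst fuel m j ++ forestsFirstAtMost fuel m j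

trees : ℕ → ℕ → List PTree
trees fuel m = map node (forests fuel m)

∈-forestsWithFirst⁻ : ∀ fuel m k {ts} → ts ∈ forestsWithFirst fuel m k →
  ∃₂ λ cs rest → cs ∈ forests fuel k × rest ∈ forests fuel (m ∸ k) × ts ≡ consNode cs rest
∈-forestsWithFirst⁻ fuel m k = ∈-cartesianProductWith⁻ consNode (forests fuel k) (forests fuel (m ∸ k))

∈-forestsFirstAtMost⁻ : ∀ fuel m j {ts} → ts ∈ forestsFirstAtMost fuel m j →
  ∃ λ k → k < j × ts ∈ forestsWithFirst fuel m k
∈-forestsFirstAtMost⁻ fuel m (suc j) ts∈ with ∈-++⁻ (forestsWithFirst fuel m j) ts∈
... | inj₁ ts∈first = j , n<1+n j , ts∈first
... | inj₂ ts∈rest with ∈-forestsFirstAtMost⁻ fuel m j ts∈rest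
...   | k , k<j , ts∈k = k , m<n⇒m<1+n k<j , ts∈k

∈-forestsFirstAtMost⁺ : ∀ fuel m {j k ts} → k < j →
  ts ∈ forestsWithFirst fuel m k → ts ∈ forestsFirstAtMost fuel m j
∈-forestsFirstAtMost⁺ fuel m {suc j} k<1+j ts∈ with m<1+n⇒m<n∨m≡n k<1+j
... | inj₁ k<j  = ∈-++⁺ʳ (forestsWithFirst fuel m j) (∈-forestsFirstAtMost⁺ fuel m k<j ts∈)
... | inj₂ refl = ∈-++⁺ˡ ts∈

forests-size : ∀ fuel m {ts} → ts ∈ forests fuel m → sizeF ts ≡ m
forests-size (suc fuel) zero    (here refl) = refl
forests-size (suc fuel) (suc m) ts∈
  with k , k<1+m , ts∈k ← ∈-forestsFirstAtMost⁻ fuel m (suc m) ts∈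
  with cs , rest , cs∈ , rest∈ , refl ← ∈-forestsWithFirst⁻ fuel m k ts∈k =
  ≡.cong suc (≡.trans (≡.cong₂ _+ℕ_ (forests-size fuel k cs∈) (forests-size fuel (m ∸ k) rest∈))
                      (m+[n∸m]≡n (≤-pred k<1+m)))

forests-complete : ∀ fuel ts → sizeF ts < fuel → ts ∈ forests fuel (sizeF ts)
forests-complete (suc fuel) []                _           = here refl
forests-complete (suc fuel) (node cs ∷ rest) (s≤s size<fuel) =
  ∈-forestsFirstAtMost⁺ fuel (j +ℕ r) (s≤s (m≤m+n j r))
    (∈-cartesianProductWith⁺ consNode cs∈ rest∈)
  where
  j = sizeF cs
  r = sizeF rest
  cs∈ : cs ∈ forests fuel j
  cs∈ = forests-complete fuel cs (≤-<-trans (m≤m+n j r) size<fuel)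
  rest∈ : rest ∈ forests fuel (j +ℕ r ∸ j)
  rest∈ = ≡.subst (λ i → rest ∈ forests fuel i) (≡.sym (m+n∸m≡n j r))
            (forests-complete fuel rest (≤-<-trans (m≤n+m r j) size<fuel))

forestsWithFirst-disjoint : ∀ fuel m {j k ts} → k < j →
  ts ∈ forestsWithFirst fuel m j → ts ∉ forestsWithFirst fuel m k
forestsWithFirst-disjoint fuel m {j} {k} k<j ts∈j ts∈k
  with cs , _ , cs∈ , _ , refl ← ∈-forestsWithFirst⁻ fuel m j ts∈j
  with _ , _ , cs∈′ , _ , refl ← ∈-forestsWithFirst⁻ fuel m k ts∈k =
  <-irrefl (≡.trans (≡.sym (forests-size fuel k cs∈′)) (forests-size fuel j cs∈)) k<j

mutual
  forests-unique : ∀ fuel m → Unique (forests fuel m)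
  forests-unique zero       m       = AllPairs.[]
  forests-unique (suc fuel) zero    = All.[] AllPairs.∷ AllPairs.[]
  forests-unique (suc fuel) (suc m) = forestsFirstAtMost-unique fuel m (suc m)

  forestsWithFirst-unique : ∀ fuel m k → Unique (forestsWithFirst fuel m k)
  forestsWithFirst-unique fuel m k = Unique.cartesianProductWith⁺ consNode consNode-injective
    (forests-unique fuel k) (forests-unique fuel (m ∸ k))

  forestsFirstAtMost-unique : ∀ fuel m j → Unique (forestsFirstAtMost fuel m j)
  forestsFirstAtMost-unique fuel m zero    = AllPairs.[]
  forestsFirstAtMost-unique fuel m (suc j) =
    Unique.++⁺ (forestsWithFirst-unique fuel m j) (forestsFirstAtMost-unique fuel m j) disjoint
    where
    disjoint : ∀ {ts} → ¬ (ts ∈ forestsWithFirst fuel m j × ts ∈ forestsFirstAtMost fuel m j)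
    disjoint (ts∈j , ts∈below) with k , k<j , ts∈k ← ∈-forestsFirstAtMost⁻ fuel m j ts∈below =
      forestsWithFirst-disjoint fuel m k<j ts∈j ts∈k

trees-enumeratePT : ∀ {fuel m} → m < fuel → EnumeratesPT (suc m) (trees fuel m)
trees-enumeratePT {fuel} {m} m<fuel =
  complete , All.tabulate sized , Unique.map⁺ node-injective (forests-unique fuel m)
  where
  complete : ∀ t → size t ≡ suc m → t ∈ trees fuel m
  complete (node cs) refl = ∈-map⁺ node (forests-complete fuel cs m<fuel)
  sized : ∀ {t} → t ∈ trees fuel m → size t ≡ suc m
  sized t∈ with cs , cs∈ , refl ← ∈-map⁻ node t∈ = ≡.cong suc (forests-size fuel m cs∈)

module _ {c ℓ} (K : Field c ℓ) where
  open Field K renaming (refl to ≈-refl)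
  open FieldOps K
  open import Algebra.Properties.Ring ring using (-0#≈0#; -‿distribˡ-*; -‿+-comm; x∙y⁻¹≈ε⇒x≈y)
  open import Algebra.Properties.CommutativeSemigroup +-commutativeSemigroup using (x∙yz≈y∙xz)
  open import Relation.Binary.Reasoning.Setoid setoid

  sumL-++ : ∀ xs ys → sumL (xs ++ ys) ≈ sumL xs + sumL ys
  sumL-++ []       ys = sym (+-identityˡ _)
  sumL-++ (x ∷ xs) ys = trans (+-congˡ (sumL-++ xs ys)) (sym (+-assoc _ _ _))

  sumL-cartesianProductWith : {A B C : Set} (_∙_ : A → B → C)
    (w : C → Carrier) (u : A → Carrier) (v : B → Carrier) →
    (∀ a b → w (a ∙ b) ≈ u a * v b) →
    ∀ xs ys → sumL (map w (cartesianProductWith _∙_ xs ys)) ≈ sumL (map u xs) * sumL (map v ys)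
  sumL-cartesianProductWith _∙_ w u v w-mult []       ys = sym (zeroˡ _)
  sumL-cartesianProductWith _∙_ w u v w-mult (x ∷ xs) ys = begin
    sumL (map w (map (x ∙_) ys ++ cartesianProductWith _∙_ xs ys))
      ≡⟨ ≡.cong sumL (map-++ w (map (x ∙_) ys) _) ⟩
    sumL (map w (map (x ∙_) ys) ++ map w (cartesianProductWith _∙_ xs ys))
      ≈⟨ sumL-++ (map w (map (x ∙_) ys)) _ ⟩
    sumL (map w (map (x ∙_) ys)) + sumL (map w (cartesianProductWith _∙_ xs ys))
      ≈⟨ +-cong (row ys) (sumL-cartesianProductWith _∙_ w u v w-mult xs ys) ⟩
    u x * sumL (map v ys) + sumL (map u xs) * sumL (map v ys)
      ≈⟨ distribʳ _ _ _ ⟨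
    sumL (map u (x ∷ xs)) * sumL (map v ys) ∎
    where
    row : ∀ ys → sumL (map w (map (x ∙_) ys)) ≈ u x * sumL (map v ys)
    row []       = sym (zeroʳ _)
    row (y ∷ ys) = trans (+-cong (w-mult x y) (row ys)) (sym (distribˡ _ _ _))

  tailConv : Series → Series → ℕ → ℕ → Carrier
  tailConv a b n zero    = 0#
  tailConv a b n (suc k) = a (suc k) * b (n ∸ suc k) + tailConv a b n k

  convAux≈head+tailConv : ∀ a b n k → convAux a b n k ≈ a 0 * b n + tailConv a b n k
  convAux≈head+tailConv a b n zero    = sym (+-identityʳ _)
  convAux≈head+tailConv a b n (suc k) =
    trans (+-congˡ (convAux≈head+tailConv a b n k)) (x∙yz≈y∙xz _ _ _)

  tailConv-oneMinus : ∀ f b n k → tailConv (oneMinus f) b n k ≈ - tailConv f b n k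
  tailConv-oneMinus f b n zero    = sym -0#≈0#
  tailConv-oneMinus f b n (suc k) = begin
    (0# - f (suc k)) * b (n ∸ suc k) + tailConv (oneMinus f) b n k
      ≈⟨ +-cong (*-congʳ (+-identityˡ _)) (tailConv-oneMinus f b n k) ⟩
    - f (suc k) * b (n ∸ suc k) + - tailConv f b n k
      ≈⟨ +-congʳ (-‿distribˡ-* _ _) ⟨
    - (f (suc k) * b (n ∸ suc k)) + - tailConv f b n k
      ≈⟨ -‿+-comm _ _ ⟩
    - tailConv f b n (suc k) ∎

  module _ {f g : Series} (f0≈0 : f 0 ≈ 0#) (fg≈1 : IsInvOneMinus f g) where
    oneMinus-head : oneMinus f 0 ≈ 1#
    oneMinus-head = trans (+-congˡ (trans (-‿cong f0≈0) -0#≈0#)) (+-identityʳ 1#)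

    invOneMinus-head : g 0 ≈ 1#
    invOneMinus-head = begin
      g 0                  ≈⟨ *-identityˡ (g 0) ⟨
      1# * g 0             ≈⟨ *-congʳ oneMinus-head ⟨
      oneMinus f 0 * g 0   ≈⟨ fg≈1 0 ⟩
      1# ∎

    invOneMinus-recurrence : ∀ m → g (suc m) ≈ tailConv f g (suc m) (suc m)
    invOneMinus-recurrence m = x∙y⁻¹≈ε⇒x≈y _ _ (begin
      g n - tailConv f g n n
        ≈⟨ +-cong (*-identityˡ (g n)) (tailConv-oneMinus f g n n) ⟨
      1# * g n + tailConv (oneMinus f) g n n
        ≈⟨ +-congʳ (*-congʳ oneMinus-head) ⟨
      oneMinus f 0 * g n + tailConv (oneMinus f) g n n
        ≈⟨ convAux≈head+tailConv (oneMinus f) g n n ⟨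
      convAux (oneMinus f) g n n
        ≈⟨ fg≈1 n ⟩
      0# ∎)
      where n = suc m

  x≈y*z⇒y≈x*z⁻¹ : ∀ {x y z} (z≉0 : ¬ (z ≈ 0#)) → x ≈ y * z → y ≈ x * inv z z≉0
  x≈y*z⇒y≈x*z⁻¹ {x} {y} {z} z≉0 x≈yz = begin
    y                    ≈⟨ *-identityʳ y ⟨
    y * 1#               ≈⟨ *-congˡ (inv-r z z≉0) ⟨
    y * (z * inv z z≉0)  ≈⟨ *-assoc y z _ ⟨
    y * z * inv z z≉0    ≈⟨ *-congʳ x≈yz ⟨
    x * inv z z≉0        ∎

  module _ (ρ : ℕ → Carrier) where
    treesWeight : List PTree → Carrier
    treesWeight ts = sumL (map (hookProd ρ) ts)

    forestsWeight : List (List PTree) → Carrier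
    forestsWeight tss = sumL (map (hookProdF ρ) tss)

    forestsWeight-++ : ∀ xss yss → forestsWeight (xss ++ yss) ≈ forestsWeight xss + forestsWeight yss
    forestsWeight-++ xss yss =
      trans (reflexive (≡.cong sumL (map-++ (hookProdF ρ) xss yss))) (sumL-++ (map (hookProdF ρ) xss) _)

    treesWeight≈root*forestsWeight : ∀ m tss → All (λ ts → sizeF ts ≡ m) tss →
      treesWeight (map node tss) ≈ ρ (suc m) * forestsWeight tss
    treesWeight≈root*forestsWeight m []        All.[]               = sym (zeroʳ _)
    treesWeight≈root*forestsWeight m (_ ∷ tss) (refl All.∷ tss-sized) =
      trans (+-congˡ (treesWeight≈root*forestsWeight m tss tss-sized)) (sym (distribˡ _ _ _))

    module _ {f g : Series} (hf : IsHookSeries ρ f) (fg≈1 : IsInvOneMinus f g) where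
      hookSeries≈treesWeight : ∀ {fuel m} → m < fuel → f (suc m) ≈ treesWeight (trees fuel m)
      hookSeries≈treesWeight m<fuel = proj₂ hf _ (s≤s z≤n) _ (trees-enumeratePT m<fuel)

      forestsWithFirst-weight : ∀ fuel m {k} → k < fuel →
        forestsWeight (forestsWithFirst fuel m k) ≈ f (suc k) * forestsWeight (forests fuel (m ∸ k))
      forestsWithFirst-weight fuel m {k} k<fuel = begin
        forestsWeight (forestsWithFirst fuel m k)
          ≈⟨ sumL-cartesianProductWith consNode (hookProdF ρ) (hookProd ρ ∘ node) (hookProdF ρ)
               (λ _ _ → ≈-refl) (forests fuel k) (forests fuel (m ∸ k)) ⟩
        sumL (map (hookProd ρ ∘ node) (forests fuel k)) * rest
          ≡⟨ ≡.cong (λ xs → sumL xs * rest) (map-∘ (forests fuel k)) ⟩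
        treesWeight (trees fuel k) * rest
          ≈⟨ *-congʳ (hookSeries≈treesWeight k<fuel) ⟨
        f (suc k) * rest ∎
        where
        rest : Carrier
        rest = forestsWeight (forests fuel (m ∸ k))

      forestsWeight≈invOneMinus : ∀ fuel m → m < fuel → forestsWeight (forests fuel m) ≈ g m
      forestsWeight≈invOneMinus (suc fuel) zero    _ =
        trans (+-identityʳ 1#) (sym (invOneMinus-head (proj₁ hf) fg≈1))
      forestsWeight≈invOneMinus (suc fuel) (suc m) (s≤s m<fuel) =
        trans (firstAtMost (suc m) ≤-refl) (sym (invOneMinus-recurrence (proj₁ hf) fg≈1 m))
        where
        firstAtMost : ∀ j → j ≤ suc m →
          forestsWeight (forestsFirstAtMost fuel m j) ≈ tailConv f g (suc m) j
        firstAtMost zero    _     = ≈-refl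
        firstAtMost (suc k) k<1+m = begin
          forestsWeight (forestsWithFirst fuel m k ++ forestsFirstAtMost fuel m k)
            ≈⟨ forestsWeight-++ (forestsWithFirst fuel m k) _ ⟩
          forestsWeight (forestsWithFirst fuel m k) + forestsWeight (forestsFirstAtMost fuel m k)
            ≈⟨ +-cong (forestsWithFirst-weight fuel m (≤-trans k<1+m m<fuel))
                      (firstAtMost k (<⇒≤ k<1+m)) ⟩
          f (suc k) * forestsWeight (forests fuel (m ∸ k)) + tailConv f g (suc m) k
            ≈⟨ +-congʳ (*-congˡ (forestsWeight≈invOneMinus fuel (m ∸ k) m∸k<fuel)) ⟩
          tailConv f g (suc m) (suc k) ∎
          where
          m∸k<fuel : m ∸ k < fuel
          m∸k<fuel = ≤-<-trans (m∸n≤m m k) m<fuel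

      hookSeries≈root*invOneMinus : ∀ m → f (suc m) ≈ ρ (suc m) * g m
      hookSeries≈root*invOneMinus m = begin
        f (suc m)
          ≈⟨ hookSeries≈treesWeight (n<1+n m) ⟩
        treesWeight (trees (suc m) m)
          ≈⟨ treesWeight≈root*forestsWeight m _ (All.tabulate (forests-size (suc m) m)) ⟩
        ρ (suc m) * forestsWeight (forests (suc m) m)
          ≈⟨ *-congˡ (forestsWeight≈invOneMinus (suc m) m (n<1+n m)) ⟩
        ρ (suc m) * g m ∎

theorem3p1 : ∀ {c ℓ} (K : Field c ℓ) →
    let open Field K
        open FieldOps K
    in (ρ : ℕ → Carrier) (f : Series) → IsHookSeries ρ f →
       (g : Series) → IsInvOneMinus f g →
       (n : ℕ) → 1 ≤ n → (p : ¬ (g (n ∸ 1) ≈ 0#)) →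
       ρ n ≈ (f n * inv (g (n ∸ 1)) p)
theorem3p1 K ρ f hf g fg≈1 (suc m) _ g≉0 =
  x≈y*z⇒y≈x*z⁻¹ K g≉0 (hookSeries≈root*invOneMinus K ρ hf fg≈1 m)
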